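{- Let $(N,a)$ be one of the pairs $(28,-7)$, $(30,5)$, $(33,-11)$, $(35,5)$, and let $p\neq 2$ be a prime such that $a$ is a square modulo $p$. Then there exist infinitely many quadratic fields generated by a point on $X_0(N)$ (i.e. infinitely many distinct fields $\mathbb{Q}(\sqrt{f_N(u)})$, $u\in\mathbb{Z}$, with $f_N(u)$ not a square) in which $p$ ramifies.
   Context: The modular curve $X_0(N)$ is given by the hyperelliptic model $y^2=f_N(x)$ with $f_{28}=4x^6-12x^5+25x^4-30x^3+25x^2-12x+4$; $f_{30}=x^8+14x^7+79x^6+242x^5+441x^4+484x^3+316x^2+112x+16$; $f_{33}=x^8+10x^6-8x^5+47x^4-40x^3+82x^2-44x+33$; $f_{35}=x^8-4x^7-6x^6-4x^5-9x^4+4x^3-6x^2+4x+1$. A point $(x_0,\sqrt{f_N(x_0)})$ with $x_0\in\mathbb{Q}$ is defined over $\mathbb{Q}(\sqrt{f_N(x_0)})$. -}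

module Defs where

open import Data.Nat using (ℕ)
open import Data.Integer using (ℤ; +_; _+_; _-_; _*_; -_)
open import Data.Integer.Divisibility using (_∣_)
open import Data.Product using (Σ; ∃; _×_)
open import Data.Sum using (_⊎_)
open import Relation.Nullary using (¬_)
open import Relation.Binary.PropositionalEquality using (_≡_)

data Case : Set where
  c28 c30 c33 c35 : Case

level : Case → ℕ
level c28 = 28
level c30 = 30
level c33 = 33
level c35 = 35

aOf : Case → ℤ
aOf c28 = - (+ 7)
aOf c30 = + 5
aOf c33 = - (+ 11)
aOf c35 = + 5

pow : ℤ → ℕ → ℤ
pow x ℕ.zero = + 1
pow x (ℕ.suc n) = x * pow x n

-- the hyperelliptic polynomials f_N, y² = f_N(x) a model of X_0(N)
f : Case → ℤ → ℤ
f c28 x = + 4 * pow x 6 - + 12 * pow x 5 + + 25 * pow x 4 - + 30 * pow x 3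
          + + 25 * pow x 2 - + 12 * x + + 4
f c30 x = pow x 8 + + 14 * pow x 7 + + 79 * pow x 6 + + 242 * pow x 5
          + + 441 * pow x 4 + + 484 * pow x 3 + + 316 * pow x 2 + + 112 * x + + 16
f c33 x = pow x 8 + + 10 * pow x 6 - + 8 * pow x 5 + + 47 * pow x 4
          - + 40 * pow x 3 + + 82 * pow x 2 - + 44 * x + + 33
f c35 x = pow x 8 - + 4 * pow x 7 - + 6 * pow x 6 - + 4 * pow x 5
          - + 9 * pow x 4 + + 4 * pow x 3 - + 6 * pow x 2 + + 4 * x + + 1

IsSquare : ℤ → Set
IsSquare d = ∃ λ k → d ≡ k * k

IsSquareMod : ℤ → ℕ → Set
IsSquareMod a p = ∃ λ x → (+ p) ∣ (x * x - a)

Squarefree : ℤ → Set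
Squarefree m = ∀ k → (k * k) ∣ m → k * k ≡ + 1

-- m is the squarefree kernel of d:  d = m k² with m squarefree (k ≠ 0);
-- then Q(√d) = Q(√m)
SqfreeKernel : ℤ → ℤ → Set
SqfreeKernel d m = Squarefree m × (∃ λ k → ¬ (k ≡ + 0) × d ≡ m * (k * k))

-- discriminant D of the quadratic field Q(√m), m squarefree, m ≠ 1:
-- D = m if m ≡ 1 (mod 4), D = 4m otherwise
QuadDisc : ℤ → ℤ → Set
QuadDisc m D = ((+ 4) ∣ (m - + 1) × D ≡ m) ⊎ (¬ ((+ 4) ∣ (m - + 1)) × D ≡ + 4 * m)

-- the prime p ramifies in Q(√d) (d a non-square): p divides the
-- discriminant of Q(√d)
Ramifies : ℕ → ℤ → Set
Ramifies p d = ∃ λ m → SqfreeKernel d m × (∃ λ D → QuadDisc m D × (+ p) ∣ D)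

-- Q(√d) = Q(√e) for nonzero d , e : d e is a square
SameField : ℤ → ℤ → Set
SameField d e = IsSquare (d * e)

{-# OPTIONS --safe #-}

-- Each f_N factors as g·h with g quadratic, 4·g(t + k) = (2t + 1)² − a and
-- α·g + β·h = R for an integer constant R. Hence if an odd prime q ∤ R exactly
-- divides (2t + 1)² − a, it exactly divides g(t + k), does not divide h(t + k),
-- and so exactly divides f_N(t + k). A square root of a modulo q can always be
-- moved to such a t; this applies to p (the odd primes dividing R are checked
-- by hand) and to arbitrarily large primes q, the prime factors of a·(B!)² − 1.
-- By the Chinese remainder theorem some u has p ∥ f_N(u) and q ∥ f_N(u): the
-- first makes f_N(u) a non-square with p ramified in Q(√f_N(u)), the second,
-- with q larger than every |d|, makes d·f_N(u) a non-square.

module Submission where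

open import Defs
open import Data.Nat as ℕ using (ℕ; zero; suc; z≤n; s≤s; _!)
import Data.Nat.Properties as ℕ
import Data.Nat.Divisibility as ℕ
import Data.Nat.DivMod as ℕ
import Data.Nat.Induction as ℕ
open import Data.Nat.Primality.Factorisation using (factorise)
open import Data.Nat.Coprimality as Coprime using (Coprime; coprime-divisor; coprime-Bézout; prime⇒coprime)
open import Data.Nat.GCD using (module Bézout)
open import Data.Nat.Primality
  using (Prime; euclidsLemma; prime⇒irreducible; prime⇒nonZero; prime[2]; ¬prime[1]; prime?)
open import Data.Integer as ℤ using (ℤ; +_; -_; _+_; _-_; _*_; ∣_∣; +[1+_]; -[1+_])
import Data.Integer.Properties as ℤ
import Data.Integer.DivMod as ℤ
open import Data.Integer.Divisibility.Signed
  using (_∣_; divides; ∣ᵤ⇒∣; ∣⇒∣ᵤ; ∣-refl; ∣-trans; ∣m∣n⇒∣m+n; ∣m∣n⇒∣m-n; ∣m⇒∣-m; ∣n⇒∣m*n; ∣m⇒∣m*n;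
         *-monoʳ-∣; *-monoˡ-∣; *-cancelˡ-∣; *-cancelʳ-∣; ∣m+n∣n⇒∣m; _∣?_)
open import Data.Integer.Divisibility using () renaming (_∣_ to _∣ᵤ_)
open import Data.Integer.Solver using (module +-*-Solver)
open import Data.Integer.Tactic.RingSolver using (solve-∀)
open import Data.Fin using (zero)
open import Data.Vec using ([]; _∷_)
open import Data.List as List using (List; []; _∷_)
open import Data.List.Relation.Unary.All as All using (All; []; _∷_)
open import Data.Nat.ListAction using (sum; product)
open import Data.Product using (∃; _×_; _,_; proj₁)
open import Data.Sum as Sum using (_⊎_; inj₁; inj₂)
open import Data.Empty using (⊥-elim)
open import Relation.Nullary using (¬_; Dec; yes; no; _×-dec_)
open import Relation.Nullary.Decidable using (from-yes; from-no; map′)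
open import Induction.WellFounded using (Acc; acc)
open import Relation.Binary.PropositionalEquality
  using (_≡_; _≢_; refl; sym; trans; cong; subst; subst₂; module ≡-Reasoning)

open +-*-Solver using (Polynomial; ⟦_⟧; op; [+]; [*]; con; var; _:^_; :-_; _:+_; _:*_; _:-_; solve; _:=_)

infix 4 _≡_[mod_]

-- A record rather than a synonym for n ∣ x - y: ℤ's _*_ unfolds under
-- unification, which would leave x and y uninferable.
record _≡_[mod_] (x y n : ℤ) : Set where
  constructor mod
  field divides-difference : n ∣ x - y

module _ {n : ℤ} where

  ≡-mod-refl : ∀ {x} → x ≡ x [mod n ]
  ≡-mod-refl {x} = mod (divides (+ 0) (ℤ.+-inverseʳ x))

  +-cong-mod : ∀ {x x′ y y′} → x ≡ x′ [mod n ] → y ≡ y′ [mod n ] → x + y ≡ x′ + y′ [mod n ]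
  +-cong-mod {x} {x′} {y} {y′} (mod h) (mod k) = mod (subst (n ∣_) (regroup x x′ y y′) (∣m∣n⇒∣m+n h k))
    where regroup : ∀ x x′ y y′ → (x - x′) + (y - y′) ≡ (x + y) - (x′ + y′)
          regroup = solve-∀

  *-cong-mod : ∀ {x x′ y y′} → x ≡ x′ [mod n ] → y ≡ y′ [mod n ] → x * y ≡ x′ * y′ [mod n ]
  *-cong-mod {x} {x′} {y} {y′} (mod h) (mod k) =
    mod (subst (n ∣_) (regroup x x′ y y′) (∣m∣n⇒∣m+n (∣m⇒∣m*n y h) (∣n⇒∣m*n x′ k)))
    where regroup : ∀ x x′ y y′ → (x - x′) * y + x′ * (y - y′) ≡ x * y - x′ * y′
          regroup = solve-∀

  neg-cong-mod : ∀ {x x′} → x ≡ x′ [mod n ] → - x ≡ - x′ [mod n ]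
  neg-cong-mod {x} {x′} (mod h) = mod (subst (n ∣_) (regroup x x′) (∣m⇒∣-m h))
    where regroup : ∀ x x′ → - (x - x′) ≡ - x - - x′
          regroup = solve-∀

  ∣-resp-≡-mod : ∀ {x y} → x ≡ y [mod n ] → n ∣ x → n ∣ y
  ∣-resp-≡-mod {x} {y} (mod n∣x-y) n∣x = subst (n ∣_) (cancel x y) (∣m∣n⇒∣m-n n∣x n∣x-y)
    where cancel : ∀ x y → x - (x - y) ≡ y
          cancel = solve-∀

  ⟦⟧-cong-mod : ∀ (P : Polynomial 1) {x y} → x ≡ y [mod n ] →
                ⟦ P ⟧ (x ∷ []) ≡ ⟦ P ⟧ (y ∷ []) [mod n ]
  ⟦⟧-cong-mod (op [+] P Q) h = +-cong-mod (⟦⟧-cong-mod P h) (⟦⟧-cong-mod Q h)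
  ⟦⟧-cong-mod (op [*] P Q) h = *-cong-mod (⟦⟧-cong-mod P h) (⟦⟧-cong-mod Q h)
  ⟦⟧-cong-mod (con c)      h = ≡-mod-refl
  ⟦⟧-cong-mod (var zero)   h = h
  ⟦⟧-cong-mod (:- P)       h = neg-cong-mod (⟦⟧-cong-mod P h)
  ⟦⟧-cong-mod (P :^ k) {x} {y} h = power k
    where power : ∀ k → ⟦ P :^ k ⟧ (x ∷ []) ≡ ⟦ P :^ k ⟧ (y ∷ []) [mod n ]
          power zero    = ≡-mod-refl
          power (suc k) = *-cong-mod (⟦⟧-cong-mod P h) (power k)

-- f in the syntax of the Simple ring solver, whose :^ computes exactly like
-- pow, so that ⟦ fPolynomial c ⟧ is definitionally f c.
fPolynomial : Case → Polynomial 1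
fPolynomial c28 = con (+ 4) :* x :^ 6 :- con (+ 12) :* x :^ 5 :+ con (+ 25) :* x :^ 4
  :- con (+ 30) :* x :^ 3 :+ con (+ 25) :* x :^ 2 :- con (+ 12) :* x :+ con (+ 4)
  where x = var zero
fPolynomial c30 = x :^ 8 :+ con (+ 14) :* x :^ 7 :+ con (+ 79) :* x :^ 6 :+ con (+ 242) :* x :^ 5
  :+ con (+ 441) :* x :^ 4 :+ con (+ 484) :* x :^ 3 :+ con (+ 316) :* x :^ 2 :+ con (+ 112) :* x :+ con (+ 16)
  where x = var zero
fPolynomial c33 = x :^ 8 :+ con (+ 10) :* x :^ 6 :- con (+ 8) :* x :^ 5 :+ con (+ 47) :* x :^ 4
  :- con (+ 40) :* x :^ 3 :+ con (+ 82) :* x :^ 2 :- con (+ 44) :* x :+ con (+ 33)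
  where x = var zero
fPolynomial c35 = x :^ 8 :- con (+ 4) :* x :^ 7 :- con (+ 6) :* x :^ 6 :- con (+ 4) :* x :^ 5
  :- con (+ 9) :* x :^ 4 :+ con (+ 4) :* x :^ 3 :- con (+ 6) :* x :^ 2 :+ con (+ 4) :* x :+ con (+ 1)
  where x = var zero

f≡⟦fPolynomial⟧ : ∀ c x → f c x ≡ ⟦ fPolynomial c ⟧ (x ∷ [])
f≡⟦fPolynomial⟧ c28 x = refl
f≡⟦fPolynomial⟧ c30 x = refl
f≡⟦fPolynomial⟧ c33 x = refl
f≡⟦fPolynomial⟧ c35 x = refl

f-cong-mod : ∀ c {n x y} → x ≡ y [mod n ] → f c x ≡ f c y [mod n ]
f-cong-mod c {n} {x} {y} h =
  subst₂ (λ u v → u ≡ v [mod n ]) (sym (f≡⟦fPolynomial⟧ c x)) (sym (f≡⟦fPolynomial⟧ c y))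
         (⟦⟧-cong-mod (fPolynomial c) h)

prime∣prime⇒≡ : ∀ {p q} → Prime p → Prime q → p ℕ.∣ q → p ≡ q
prime∣prime⇒≡ p-prime q-prime p∣q with prime⇒irreducible q-prime p∣q
... | inj₁ refl = ⊥-elim (¬prime[1] p-prime)
... | inj₂ p≡q  = p≡q

prime∣^⇒∣ : ∀ {p m} → Prime p → ∀ k → p ℕ.∣ m ℕ.^ k → p ℕ.∣ m
prime∣^⇒∣ p-prime zero    p∣1 = ⊥-elim (¬prime[1] (subst Prime (ℕ.∣1⇒≡1 p∣1) p-prime))
prime∣^⇒∣ {m = m} p-prime (suc k) p∣mᵏ⁺¹ with euclidsLemma m (m ℕ.^ k) p-prime p∣mᵏ⁺¹
... | inj₁ p∣m  = p∣m
... | inj₂ p∣mᵏ = prime∣^⇒∣ p-prime k p∣mᵏ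

oddPrime∤2^ : ∀ {p} → Prime p → p ≢ 2 → ∀ k → ¬ p ℕ.∣ 2 ℕ.^ k
oddPrime∤2^ p-prime p≢2 k p∣2ᵏ = p≢2 (prime∣prime⇒≡ p-prime prime[2] (prime∣^⇒∣ p-prime k p∣2ᵏ))

oddPrime≡2v+1 : ∀ {q} → Prime q → q ≢ 2 → ∃ λ v → + q ≡ + 2 * v + + 1
oddPrime≡2v+1 {q} q-prime q≢2 with q ℕ.% 2 | ℕ.m%n<n q 2 | ℕ.m≡m%n+[m/n]*n q 2
... | 0 | _ | q≡[q/2]*2 =
  ⊥-elim (q≢2 (sym (prime∣prime⇒≡ prime[2] q-prime (ℕ.divides (q ℕ./ 2) q≡[q/2]*2))))
... | 1 | _ | q≡1+[q/2]*2 = + (q ℕ./ 2) , (begin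
  + q                             ≡⟨ cong +_ q≡1+[q/2]*2 ⟩
  + (1 ℕ.+ q ℕ./ 2 ℕ.* 2)         ≡⟨ ℤ.pos-+ 1 (q ℕ./ 2 ℕ.* 2) ⟩
  + 1 + + (q ℕ./ 2 ℕ.* 2)         ≡⟨ cong (λ z → + 1 + z) (ℤ.pos-* (q ℕ./ 2) 2) ⟩
  + 1 + + (q ℕ./ 2) * + 2         ≡⟨ regroup (+ (q ℕ./ 2)) ⟩
  + 2 * + (q ℕ./ 2) + + 1         ∎)
  where
  open ≡-Reasoning
  regroup : ∀ v → + 1 + v * + 2 ≡ + 2 * v + + 1
  regroup = solve-∀
... | suc (suc _) | s≤s (s≤s ()) | _

oddPrime∣2^i*m⇒∣m : ∀ {p m} → Prime p → p ≢ 2 → ∀ i → p ℕ.∣ 2 ℕ.^ i ℕ.* m → p ℕ.∣ m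
oddPrime∣2^i*m⇒∣m {m = m} p-prime p≢2 i p∣2ⁱm with euclidsLemma (2 ℕ.^ i) m p-prime p∣2ⁱm
... | inj₁ p∣2ⁱ = ⊥-elim (oddPrime∤2^ p-prime p≢2 i p∣2ⁱ)
... | inj₂ p∣m  = p∣m

prime²∤prime : ∀ {q r} → Prime q → Prime r → ¬ q ℕ.* q ℕ.∣ r
prime²∤prime {q} q-prime r-prime q²∣r with prime∣prime⇒≡ q-prime r-prime (ℕ.∣-trans (ℕ.m∣m*n q) q²∣r)
... | refl = ¬prime[1] (subst Prime (ℕ.∣1⇒≡1 q∣1) q-prime)
  where
  instance _ = prime⇒nonZero q-prime
  q∣1 : q ℕ.∣ 1
  q∣1 = ℕ.*-cancelˡ-∣ q (subst (q ℕ.* q ℕ.∣_) (sym (ℕ.*-identityʳ q)) q²∣r)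

∃prime∣ : ∀ {n} → 2 ℕ.≤ n → ∃ λ q → Prime q × q ℕ.∣ n
∃prime∣ {n} 2≤n with factorise n {{ℕ.>-nonZero (ℕ.<-trans (s≤s z≤n) 2≤n)}}
... | record { factors = q ∷ qs ; isFactorisation = refl ; factorsPrime = q-prime ∷ _ } =
  q , q-prime , ℕ.m∣m*n (product qs)
... | record { factors = [] ; isFactorisation = refl } with 2≤n
...   | s≤s ()

∣! : ∀ {m n} → 1 ℕ.≤ m → m ℕ.≤ n → m ℕ.∣ n !
∣! {n = zero}  (s≤s _) ()
∣! {n = suc n} 1≤m m≤1+n with ℕ.m≤n⇒m<n∨m≡n m≤1+n
... | inj₁ (s≤s m≤n) = ℕ.∣-trans (∣! 1≤m m≤n) (ℕ.n∣m*n (suc n))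
... | inj₂ refl      = ℕ.m∣m*n (n !)

prime∤n!⇒n< : ∀ {p} n → Prime p → ¬ p ℕ.∣ n ! → n ℕ.< p
prime∤n!⇒n< {p} n p-prime p∤n! =
  ℕ.≰⇒> (λ p≤n → p∤n! (∣! (ℕ.>-nonZero⁻¹ p {{prime⇒nonZero p-prime}}) p≤n))

coprime-*ʳ : ∀ {m n o} → Coprime m n → Coprime m o → Coprime m (n ℕ.* o)
coprime-*ʳ {m} {n} m⊥n m⊥o (i∣m , i∣no) = m⊥o (i∣m , coprime-divisor i⊥n i∣no)
  where
  i⊥n : Coprime _ n
  i⊥n (j∣i , j∣n) = m⊥n (ℕ.∣-trans j∣i i∣m , j∣n)

coprime-² : ∀ {m n} → Coprime m n → Coprime (m ℕ.* m) (n ℕ.* n)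
coprime-² m⊥n = Coprime.sym (coprime-*ʳ n⊥m² n⊥m²)
  where
  n⊥m² = Coprime.sym (coprime-*ʳ m⊥n m⊥n)

crt-idempotent : ∀ {m n} → Coprime m n → ∃ λ e → (+ m ∣ e) × (+ n ∣ e - + 1)
crt-idempotent {m} {n} m⊥n with coprime-Bézout m⊥n
... | Bézout.+- a b 1+bn≡am = + (a ℕ.* m) , divides (+ a) (ℤ.pos-* a m) , divides (+ b) e-1≡bn
  where
  e-1≡bn : + (a ℕ.* m) - + 1 ≡ + b * + n
  e-1≡bn = trans (cong (λ k → + k - + 1) (sym 1+bn≡am)) (ℤ.pos-* b n)
... | Bézout.-+ a b 1+am≡bn = - + (a ℕ.* m) , ∣m⇒∣-m (divides (+ a) (ℤ.pos-* a m)) ,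
  subst (+ n ∣_) -[1+am]≡e-1 (∣m⇒∣-m (divides (+ b) (trans (cong +_ 1+am≡bn) (ℤ.pos-* b n))))
  where
  regroup : ∀ z → - (+ 1 + z) ≡ - z - + 1
  regroup = solve-∀
  -[1+am]≡e-1 : - + (1 ℕ.+ a ℕ.* m) ≡ - + (a ℕ.* m) - + 1
  -[1+am]≡e-1 = trans (cong -_ (ℤ.pos-+ 1 (a ℕ.* m))) (regroup (+ (a ℕ.* m)))

crt : ∀ {m n} → Coprime m n → ∀ x y → ∃ λ u → u ≡ x [mod + m ] × u ≡ y [mod + n ]
crt m⊥n x y =
  let e , m∣e , n∣e-1 = crt-idempotent m⊥n
  in  x + (y - x) * e ,
      mod (subst (_ ∣_) (≡mod-m x y e) (∣n⇒∣m*n (y - x) m∣e)) ,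
      mod (subst (_ ∣_) (≡mod-n x y e) (∣n⇒∣m*n (y - x) n∣e-1))
  where
  ≡mod-m : ∀ x y e → (y - x) * e ≡ x + (y - x) * e - x
  ≡mod-m = solve-∀
  ≡mod-n : ∀ x y e → (y - x) * (e - + 1) ≡ x + (y - x) * e - y
  ≡mod-n = solve-∀

squarefree⊎square∣ : ∀ d → d ≢ + 0 → Squarefree d ⊎ ∃ λ j → 2 ℕ.≤ j × + (j ℕ.* j) ∣ d
squarefree⊎square∣ d d≢0 with ℕ.anyUpTo? (λ j → (2 ℕ.≤? j) ×-dec (j ℕ.* j ℕ.∣? ∣ d ∣)) (suc ∣ d ∣)
... | yes (j , _ , 2≤j , j²∣d) = inj₂ (j , 2≤j , ∣ᵤ⇒∣ j²∣d)
... | no none = inj₁ squarefree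
  where
  instance _ = ℕ.≢-nonZero (λ ∣d∣≡0 → d≢0 (ℤ.∣i∣≡0⇒i≡0 ∣d∣≡0))
  no-square-divisor : ∀ j → 2 ℕ.≤ j → ¬ (j ℕ.* j ℕ.∣ ∣ d ∣)
  no-square-divisor j@(suc _) 2≤j j²∣d =
    none (j , s≤s (ℕ.≤-trans (ℕ.m≤m*n j j) (ℕ.∣⇒≤ j²∣d)) , 2≤j , j²∣d)
  squarefree : Squarefree d
  squarefree (+ 0)            0∣d  = ⊥-elim (d≢0 (ℤ.∣i∣≡0⇒i≡0 (ℕ.0∣⇒≡0 0∣d)))
  squarefree (+ 1)            _    = refl
  squarefree -[1+ 0 ]         _    = refl
  squarefree k@(+[1+ suc n ]) k²∣d =
    ⊥-elim (no-square-divisor (2 ℕ.+ n) (s≤s (s≤s z≤n)) (subst (ℕ._∣ ∣ d ∣) (ℤ.abs-* k k) k²∣d))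
  squarefree k@(-[1+ suc n ]) k²∣d =
    ⊥-elim (no-square-divisor (2 ℕ.+ n) (s≤s (s≤s z≤n)) (subst (ℕ._∣ ∣ d ∣) (ℤ.abs-* k k) k²∣d))

squarefree-kernel : ∀ d → d ≢ + 0 → ∃ (SqfreeKernel d)
squarefree-kernel d d≢0 = kernel d d≢0 (ℕ.<-wellFounded ∣ d ∣)
  where
  kernel : ∀ d → d ≢ + 0 → Acc ℕ._<_ ∣ d ∣ → ∃ (SqfreeKernel d)
  kernel d d≢0 (acc rec) with squarefree⊎square∣ d d≢0
  ... | inj₁ d-squarefree = d , d-squarefree , + 1 , (λ ()) , sym (ℤ.*-identityʳ d)
  ... | inj₂ (j , 2≤j , divides d′ refl) with kernel d′ d′≢0 (rec ∣d′∣<∣d∣)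
    where
    d′≢0 : d′ ≢ + 0
    d′≢0 refl = d≢0 refl
    instance _ = ℕ.≢-nonZero (λ ∣d′∣≡0 → d′≢0 (ℤ.∣i∣≡0⇒i≡0 ∣d′∣≡0))
    ∣d′∣<∣d∣ : ∣ d′ ∣ ℕ.< ∣ d′ * + (j ℕ.* j) ∣
    ∣d′∣<∣d∣ = subst (∣ d′ ∣ ℕ.<_) (sym (ℤ.abs-* d′ (+ (j ℕ.* j))))
                 (ℕ.m<m*n ∣ d′ ∣ (j ℕ.* j) (ℕ.≤-trans (s≤s (s≤s z≤n)) (ℕ.*-mono-≤ 2≤j 2≤j)))
  ... | m , m-squarefree , k , k≢0 , refl =
    m , m-squarefree , k * + j , kj≢0 , trans (cong (m * (k * k) *_) (ℤ.pos-* j j)) (regroup m k (+ j))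
    where
    regroup : ∀ m k j → m * (k * k) * (j * j) ≡ m * ((k * j) * (k * j))
    regroup = solve-∀
    kj≢0 : k * + j ≢ + 0
    kj≢0 kj≡0 with ℤ.i*j≡0⇒i≡0∨j≡0 k kj≡0
    ... | inj₁ k≡0 = k≢0 k≡0
    ... | inj₂ j≡0 = ℕ.<⇒≢ (ℕ.<-trans (s≤s z≤n) 2≤j) (sym (cong ∣_∣ j≡0))

infix 4 _∥_

_∥_ : ℕ → ℤ → Set
p ∥ n = + p ∣ n × ¬ (+ p * + p ∣ n)

∥-resp-≡-mod : ∀ {p m n} → p ∥ m → n ≡ m [mod + p * + p ] → p ∥ n
∥-resp-≡-mod {p} {m} {n} (p∣m , p²∤m) (mod p²∣n-m) =
  subst (+ p ∣_) (cancel n m) (∣m∣n⇒∣m+n (∣-trans (∣n⇒∣m*n (+ p) ∣-refl) p²∣n-m) p∣m) ,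
  λ p²∣n → p²∤m (subst (+ p * + p ∣_) (cancel′ n m) (∣m∣n⇒∣m-n p²∣n p²∣n-m))
  where
  cancel : ∀ n m → n - m + m ≡ n
  cancel = solve-∀
  cancel′ : ∀ n m → n - (n - m) ≡ m
  cancel′ = solve-∀

∥⇒≢0 : ∀ {p n} → p ∥ n → n ≢ + 0
∥⇒≢0 (_ , p²∤0) refl = p²∤0 (divides (+ 0) refl)

∣⇒*∣* : ∀ {k m} → k ∣ m → k * k ∣ m * m
∣⇒*∣* {k} {m} k∣m = ∣-trans (*-monoʳ-∣ k k∣m) (*-monoˡ-∣ m k∣m)

module _ {p : ℕ} (p-prime : Prime p) where

  prime-∣-* : ∀ m n → + p ∣ m * n → (+ p ∣ m) ⊎ (+ p ∣ n)
  prime-∣-* m n p∣mn =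
    Sum.map ∣ᵤ⇒∣ ∣ᵤ⇒∣
      (euclidsLemma ∣ m ∣ ∣ n ∣ p-prime (subst (p ℕ.∣_) (ℤ.abs-* m n) (∣⇒∣ᵤ p∣mn)))

  prime∣*∧∤ʳ⇒∣ˡ : ∀ {m n} → ¬ + p ∣ n → + p ∣ m * n → + p ∣ m
  prime∣*∧∤ʳ⇒∣ˡ {m} {n} p∤n p∣mn with prime-∣-* m n p∣mn
  ... | inj₁ p∣m = p∣m
  ... | inj₂ p∣n = ⊥-elim (p∤n p∣n)

  prime∣*∧∤ˡ⇒∣ʳ : ∀ {m n} → ¬ + p ∣ m → + p ∣ m * n → + p ∣ n
  prime∣*∧∤ˡ⇒∣ʳ {m} {n} p∤m p∣mn = prime∣*∧∤ʳ⇒∣ˡ p∤m (subst (+ p ∣_) (ℤ.*-comm m n) p∣mn)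

  prime∣square⇒prime²∣square : ∀ k → + p ∣ k * k → + p * + p ∣ k * k
  prime∣square⇒prime²∣square k p∣k² with prime-∣-* k k p∣k²
  ... | inj₁ p∣k = ∣⇒*∣* p∣k
  ... | inj₂ p∣k = ∣⇒*∣* p∣k

  prime²∣*∧∤ʳ⇒prime²∣ˡ : ∀ {m n} → ¬ + p ∣ n → + p * + p ∣ m * n → + p * + p ∣ m
  prime²∣*∧∤ʳ⇒prime²∣ˡ {m} {n} p∤n p²∣mn
    with prime∣*∧∤ʳ⇒∣ˡ {m} {n} p∤n (∣-trans (∣n⇒∣m*n (+ p) (∣-refl {+ p})) p²∣mn)
  ... | divides m′ refl = *-monoˡ-∣ (+ p) {+ p} {m′} (prime∣*∧∤ʳ⇒∣ˡ p∤n p∣m′n)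
    where
    regroup : ∀ m′ n p → m′ * p * n ≡ (m′ * n) * p
    regroup = solve-∀
    p∣m′n : + p ∣ m′ * n
    p∣m′n = *-cancelʳ-∣ (+ p) {+ p} {m′ * n} {{prime⇒nonZero p-prime}}
              (subst (+ p * + p ∣_) (regroup m′ n (+ p)) p²∣mn)

  ∥⇒¬IsSquare : ∀ {n} → p ∥ n → ¬ IsSquare n
  ∥⇒¬IsSquare (p∣k² , p²∤k²) (k , refl) = p²∤k² (prime∣square⇒prime²∣square k p∣k²)

  ∥-*-∤ : ∀ {m n} → p ∥ m → ¬ + p ∣ n → p ∥ m * n
  ∥-*-∤ {m} {n} (p∣m , p²∤m) p∤n =
    ∣m⇒∣m*n n p∣m , λ p²∣mn → p²∤m (prime²∣*∧∤ʳ⇒prime²∣ˡ p∤n p²∣mn)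

  ∥-cancelˡ : ∀ {k m} → ¬ + p ∣ k → p ∥ k * m → p ∥ m
  ∥-cancelˡ {k} {m} p∤k (p∣km , p²∤km) =
    prime∣*∧∤ˡ⇒∣ʳ p∤k p∣km , λ p²∣m → p²∤km (∣n⇒∣m*n k p²∣m)

  ∥∧∤⇒¬SameField : ∀ {m d} → p ∥ m → ¬ + p ∣ d → ¬ SameField d m
  ∥∧∤⇒¬SameField {m} {d} (p∣m , p²∤m) p∤d (k , dm≡k²) =
    p²∤m (prime²∣*∧∤ʳ⇒prime²∣ˡ p∤d p²∣md)
    where
    p²∣md : + p * + p ∣ m * d
    p²∣md = subst (+ p * + p ∣_) (trans (sym dm≡k²) (ℤ.*-comm d m))
              (prime∣square⇒prime²∣square k (subst (+ p ∣_) dm≡k² (∣n⇒∣m*n d p∣m)))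

  ∥⇒Ramifies : ∀ {n} → p ∥ n → Ramifies p n
  ∥⇒Ramifies {n} p∥n@(p∣n , p²∤n) with squarefree-kernel n (∥⇒≢0 p∥n)
  ... | m , m-squarefree , k , k≢0 , refl = m , (m-squarefree , k , k≢0 , refl) , discriminant
    where
    p∤k² : ¬ + p ∣ k * k
    p∤k² p∣k² = p²∤n (∣n⇒∣m*n m (prime∣square⇒prime²∣square k p∣k²))
    p∣m : + p ∣ m
    p∣m = prime∣*∧∤ʳ⇒∣ˡ p∤k² p∣n
    discriminant : ∃ λ D → QuadDisc m D × + p ∣ᵤ D
    discriminant with 4 ℕ.∣? ∣ m - + 1 ∣
    ... | yes 4∣m-1 = m , inj₁ (4∣m-1 , refl) , ∣⇒∣ᵤ p∣m
    ... | no  4∤m-1 = + 4 * m , inj₂ (4∤m-1 , refl) , ∣⇒∣ᵤ (∣n⇒∣m*n (+ 4) p∣m)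

oddSquare : ℤ → ℤ
oddSquare t = (+ 2 * t + + 1) * (+ 2 * t + + 1)

module _ {q : ℕ} (q-prime : Prime q) (q≢2 : q ≢ 2) where

  oddPrime∤4 : ¬ + q ∣ + 4
  oddPrime∤4 q∣4 = oddPrime∤2^ q-prime q≢2 2 (∣⇒∣ᵤ q∣4)

  -- 2t + 1 = (q + 1)s + q is odd and congruent to s modulo q.
  ∣s²-a⇒∣oddSquare-a : ∀ {a s} → + q ∣ s * s - a → ∃ λ t → + q ∣ oddSquare t - a
  ∣s²-a⇒∣oddSquare-a {a} {s} q∣s²-a with oddPrime≡2v+1 q-prime q≢2
  ... | v , q≡2v+1 = (v + + 1) * s + v , subst (+ q ∣_) (sym (shift v s a)) (∣m∣n⇒∣m+n q∣s²-a q∣qY)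
    where
    Y : ℤ
    Y = (s + + 1) * ((+ 2 * v + + 2) * s + (+ 2 * v + + 1) + s)
    q∣qY : + q ∣ (+ 2 * v + + 1) * Y
    q∣qY = subst (λ z → + q ∣ z * Y) q≡2v+1 (∣m⇒∣m*n Y ∣-refl)
    shift : ∀ v s a → (+ 2 * ((v + + 1) * s + v) + + 1) * (+ 2 * ((v + + 1) * s + v) + + 1) - a
                    ≡ (s * s - a) + (+ 2 * v + + 1) * ((s + + 1) * ((+ 2 * v + + 2) * s + (+ 2 * v + + 1) + s))
    shift = solve-∀

  oddSquare-step : ∀ a t → oddSquare (t + + q) - a ≡ (oddSquare t - a) + + q * (+ 4 * (+ 2 * t + + 1 + + q))
  oddSquare-step a t = expand t (+ q) a
    where
    expand : ∀ t q a → (+ 2 * (t + q) + + 1) * (+ 2 * (t + q) + + 1) - a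
                     ≡ ((+ 2 * t + + 1) * (+ 2 * t + + 1) - a) + q * (+ 4 * (+ 2 * t + + 1 + q))
    expand = solve-∀

  -- Moving t to t + q adds q·4(2t + 1 + q); if q² divided both values, q would
  -- divide 2t + 1, and then q² would divide a.
  q²∣oddSquare-a-twice⇒q²∣a : ∀ a t → + q * + q ∣ oddSquare t - a →
                              + q * + q ∣ oddSquare (t + + q) - a → + q * + q ∣ a
  q²∣oddSquare-a-twice⇒q²∣a a t q²∣E q²∣E′ =
    subst (+ q * + q ∣_) (square-minus T a) (∣m∣n⇒∣m-n (∣⇒*∣* q∣T) q²∣E)
    where
    T : ℤ
    T = + 2 * t + + 1
    cancel : ∀ x y → x + y - x ≡ y
    cancel = solve-∀
    square-minus : ∀ x a → x * x - (x * x - a) ≡ a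
    square-minus = solve-∀
    q²∣q*4[T+q] : + q * + q ∣ + q * (+ 4 * (T + + q))
    q²∣q*4[T+q] = subst (+ q * + q ∣_) (trans (cong (_- (oddSquare t - a)) (oddSquare-step a t))
                                              (cancel (oddSquare t - a) (+ q * (+ 4 * (T + + q)))))
                    (∣m∣n⇒∣m-n q²∣E′ q²∣E)
    q∣T+q : + q ∣ T + + q
    q∣T+q = prime∣*∧∤ˡ⇒∣ʳ q-prime oddPrime∤4
              (*-cancelˡ-∣ (+ q) {+ q} {+ 4 * (T + + q)} {{prime⇒nonZero q-prime}} q²∣q*4[T+q])
    q∣T : + q ∣ T
    q∣T = ∣m+n∣n⇒∣m q∣T+q ∣-refl

  ∣oddSquare-a⇒∥oddSquare-a : ∀ {a} → ¬ (+ q * + q ∣ a) → ∀ t → + q ∣ oddSquare t - a →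
                              ∃ λ t′ → q ∥ oddSquare t′ - a
  ∣oddSquare-a⇒∥oddSquare-a {a} q²∤a t q∣E with + q * + q ∣? oddSquare t - a
  ... | no  q²∤E = t , q∣E , q²∤E
  ... | yes q²∣E = t + + q , q∣E′ , λ q²∣E′ → q²∤a (q²∣oddSquare-a-twice⇒q²∣a a t q²∣E q²∣E′)
    where
    q∣E′ : + q ∣ oddSquare (t + + q) - a
    q∣E′ = subst (+ q ∣_) (sym (oddSquare-step a t))
             (∣m∣n⇒∣m+n q∣E (∣m⇒∣m*n (+ 4 * (+ 2 * t + + 1 + + q)) (∣-refl {+ q})))

  ∣s²-a⇒∥oddSquare-a : ∀ {a s} → ¬ (+ q * + q ∣ a) → + q ∣ s * s - a → ∃ λ t → q ∥ oddSquare t - a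
  ∣s²-a⇒∥oddSquare-a {a} {s} q²∤a q∣s²-a with ∣s²-a⇒∣oddSquare-a {a} {s} q∣s²-a
  ... | t , q∣E = ∣oddSquare-a⇒∥oddSquare-a q²∤a t q∣E

record Splitting (c : Case) : Set where
  field
    g h α β        : ℤ → ℤ
    resultant      : ℕ
    shift          : ℤ
    1<resultant    : 1 ℕ.< resultant
    f≡g*h          : ∀ x → f c x ≡ g x * h x
    bézout         : ∀ x → α x * g x + β x * h x ≡ + resultant
    -- oddSquare t spelled out, so that solve-∀ can read the instances.
    4g≡oddSquare-a : ∀ t → + 4 * g (t + shift) ≡ (+ 2 * t + + 1) * (+ 2 * t + + 1) - aOf c

  ∥oddSquare-a⇒∥f : ∀ {q} → Prime q → q ≢ 2 → ¬ + q ∣ + resultant →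
                    ∀ t → q ∥ oddSquare t - aOf c → q ∥ f c (t + shift)
  ∥oddSquare-a⇒∥f q-prime q≢2 q∤R t q∥E =
    subst (_ ∥_) (sym (f≡g*h x)) (∥-*-∤ q-prime {g x} {h x} q∥g q∤h)
    where
    x : ℤ
    x = t + shift
    q∥g : _ ∥ g x
    q∥g = ∥-cancelˡ q-prime {+ 4} {g x} (oddPrime∤4 q-prime q≢2)
            (subst (_ ∥_) (sym (4g≡oddSquare-a t)) q∥E)
    q∤h : ¬ + _ ∣ h x
    q∤h q∣h = q∤R (subst (_ ∣_) (bézout x)
                (∣m∣n⇒∣m+n (∣n⇒∣m*n (α x) {g x} (proj₁ q∥g)) (∣n⇒∣m*n (β x) {h x} q∣h)))

splitting : ∀ c → Splitting c
splitting c28 = record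
  { g = λ x → x * x - x + + 2
  ; h = λ x → (((+ 4 * x - + 8) * x + + 9) * x - + 5) * x + + 2
  ; α = λ x → (- + 4 * x + + 4) * x + + 3
  ; β = λ _ → + 1
  ; resultant = 8
  ; shift = + 1
  ; 1<resultant = s≤s (s≤s z≤n)
  ; f≡g*h = solve 1 (λ x → fPolynomial c28 :=
      (x :* x :- x :+ con (+ 2)) :*
      ((((con (+ 4) :* x :- con (+ 8)) :* x :+ con (+ 9)) :* x :- con (+ 5)) :* x :+ con (+ 2))) refl
  ; bézout = solve-∀
  ; 4g≡oddSquare-a = solve-∀
  }
splitting c30 = record
  { g = λ x → x * x + + 3 * x + + 1
  ; h = λ x → (((((x + + 11) * x + + 45) * x + + 96) * x + + 108) * x + + 64) * x + + 16
  ; α = λ x → ((((- + 2 * x - + 21) * x - + 80) * x - + 156) * x - + 148) * x - + 68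
  ; β = λ x → + 2 * x + + 5
  ; resultant = 12
  ; shift = - + 1
  ; 1<resultant = s≤s (s≤s z≤n)
  ; f≡g*h = solve 1 (λ x → fPolynomial c30 :=
      (x :* x :+ con (+ 3) :* x :+ con (+ 1)) :*
      ((((((x :+ con (+ 11)) :* x :+ con (+ 45)) :* x :+ con (+ 96)) :* x :+ con (+ 108)) :* x
        :+ con (+ 64)) :* x :+ con (+ 16))) refl
  ; bézout = solve-∀
  ; 4g≡oddSquare-a = solve-∀
  }
splitting c33 = record
  { g = λ x → x * x - x + + 3
  ; h = λ x → (((((x + + 1) * x + + 8) * x - + 3) * x + + 20) * x - + 11) * x + + 11
  ; α = λ x → ((((- + 2 * x - + 7) * x - + 20) * x - + 17) * x + + 12) * x + + 25
  ; β = λ x → + 2 * x + + 3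
  ; resultant = 108
  ; shift = + 1
  ; 1<resultant = s≤s (s≤s z≤n)
  ; f≡g*h = solve 1 (λ x → fPolynomial c33 :=
      (x :* x :- x :+ con (+ 3)) :*
      ((((((x :+ con (+ 1)) :* x :+ con (+ 8)) :* x :- con (+ 3)) :* x :+ con (+ 20)) :* x
        :- con (+ 11)) :* x :+ con (+ 11))) refl
  ; bézout = solve-∀
  ; 4g≡oddSquare-a = solve-∀
  }
splitting c35 = record
  { g = λ x → x * x + x - + 1
  ; h = λ x → (((x - + 5) * x * x - + 9) * x * x - + 5) * x - + 1
  ; α = λ x → ((((+ 2 * x - + 9) * x - + 4) * x - + 23) * x - + 8) * x - + 25
  ; β = λ x → - + 2 * x - + 3
  ; resultant = 28
  ; shift = + 0
  ; 1<resultant = s≤s (s≤s z≤n)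
  ; f≡g*h = solve 1 (λ x → fPolynomial c35 :=
      (x :* x :+ x :- con (+ 1)) :*
      ((((x :- con (+ 5)) :* x :* x :- con (+ 9)) :* x :* x :- con (+ 5)) :* x :- con (+ 1))) refl
  ; bézout = solve-∀
  ; 4g≡oddSquare-a = solve-∀
  }

resultant : Case → ℕ
resultant c = Splitting.resultant (splitting c)

∣aOf∣-prime : ∀ c → Prime ∣ aOf c ∣
∣aOf∣-prime c28 = from-yes (prime? 7)
∣aOf∣-prime c30 = from-yes (prime? 5)
∣aOf∣-prime c33 = from-yes (prime? 11)
∣aOf∣-prime c35 = from-yes (prime? 5)

prime²∤aOf : ∀ c {q} → Prime q → ¬ (+ q * + q ∣ aOf c)
prime²∤aOf c {q} q-prime q²∣a =
  prime²∤prime q-prime (∣aOf∣-prime c) (subst (ℕ._∣ ∣ aOf c ∣) (ℤ.abs-* (+ q) (+ q)) (∣⇒∣ᵤ q²∣a))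

3≤∣aOf∣ : ∀ c → 3 ℕ.≤ ∣ aOf c ∣
3≤∣aOf∣ c28 = s≤s (s≤s (s≤s z≤n))
3≤∣aOf∣ c30 = s≤s (s≤s (s≤s z≤n))
3≤∣aOf∣ c33 = s≤s (s≤s (s≤s z≤n))
3≤∣aOf∣ c35 = s≤s (s≤s (s≤s z≤n))

isSquareMod? : ∀ a n .{{_ : ℕ.NonZero n}} → Dec (IsSquareMod a n)
isSquareMod? a n = map′ (λ (r , _ , n∣r²-a) → + r , n∣r²-a) reduce
                        (ℕ.anyUpTo? (λ r → n ℕ.∣? ∣ + r * + r - a ∣) n)
  where
  reduce : IsSquareMod a n → ∃ λ r → r ℕ.< n × + n ∣ᵤ + r * + r - a
  reduce (x , n∣x²-a) = r , ℤ.n%d<d x (+ n) , ∣⇒∣ᵤ (∣-resp-≡-mod x²-a≡r²-a (∣ᵤ⇒∣ n∣x²-a))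
    where
    r : ℕ
    r = x ℤ.% + n
    x≡r : x ≡ + r [mod + n ]
    x≡r = mod (divides (x ℤ./ + n)
            (trans (cong (_- + r) (ℤ.a≡a%n+[a/n]*n x (+ n))) (cancel (+ r) (x ℤ./ + n * + n))))
      where cancel : ∀ r y → r + y - r ≡ y
            cancel = solve-∀
    x²-a≡r²-a : x * x - a ≡ + r * + r - a [mod + n ]
    x²-a≡r²-a = +-cong-mod (*-cong-mod x≡r x≡r) ≡-mod-refl

exact-from-root : ∀ c {q} → Prime q → q ≢ 2 → ¬ + q ∣ + resultant c →
                  ∀ {s} → + q ∣ s * s - aOf c → ∃ λ x → q ∥ f c x
exact-from-root c q-prime q≢2 q∤R {s} q∣s²-a
  with ∣s²-a⇒∥oddSquare-a q-prime q≢2 {aOf c} {s} (prime²∤aOf c q-prime) q∣s²-a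
... | t , q∥E = t + shift , ∥oddSquare-a⇒∥f q-prime q≢2 q∤R t q∥E
  where open Splitting (splitting c)

-- The odd primes dividing the resultants 8, 12, 108, 28 are 3 and 7. For N = 30
-- and 35 they are excluded as 5 is not a square modulo 3 or 7; for N = 33,
-- f(0) = 33 = 3 · 11.
exact-at-resultant-prime : ∀ c {p} → Prime p → p ≢ 2 → IsSquareMod (aOf c) p →
                           p ℕ.∣ resultant c → ∃ λ x → p ∥ f c x
exact-at-resultant-prime c28 p-prime p≢2 _ p∣2³ = ⊥-elim (oddPrime∤2^ p-prime p≢2 3 p∣2³)
exact-at-resultant-prime c30 p-prime p≢2 5-square p∣2²*3
  with prime∣prime⇒≡ p-prime (from-yes (prime? 3)) (oddPrime∣2^i*m⇒∣m p-prime p≢2 2 p∣2²*3)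
... | refl = ⊥-elim (from-no (isSquareMod? (+ 5) 3) 5-square)
exact-at-resultant-prime c33 p-prime p≢2 _ p∣2²*3³
  with prime∣prime⇒≡ p-prime (from-yes (prime? 3))
         (prime∣^⇒∣ p-prime 3 (oddPrime∣2^i*m⇒∣m p-prime p≢2 2 p∣2²*3³))
... | refl = + 0 , from-yes (+ 3 ∣? + 33) , from-no (+ 9 ∣? + 33)
exact-at-resultant-prime c35 p-prime p≢2 5-square p∣2²*7
  with prime∣prime⇒≡ p-prime (from-yes (prime? 7)) (oddPrime∣2^i*m⇒∣m p-prime p≢2 2 p∣2²*7)
... | refl = ⊥-elim (from-no (isSquareMod? (+ 5) 7) 5-square)

exact-at-prime : ∀ c {p} → Prime p → p ≢ 2 → IsSquareMod (aOf c) p → ∃ λ x → p ∥ f c x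
exact-at-prime c {p} p-prime p≢2 a-square@(s , p∣s²-a) with p ℕ.∣? resultant c
... | yes p∣R = exact-at-resultant-prime c p-prime p≢2 a-square p∣R
... | no  p∤R = exact-from-root c p-prime p≢2 (λ p∣R → p∤R (∣⇒∣ᵤ p∣R)) {s} (∣ᵤ⇒∣ p∣s²-a)

2≤∣a*M²-1∣ : ∀ a M → 3 ℕ.≤ ∣ a ∣ → 1 ℕ.≤ M → 2 ℕ.≤ ∣ a * (+ M * + M) - + 1 ∣
2≤∣a*M²-1∣ a M 3≤∣a∣ 1≤M = ℕ.+-cancelʳ-≤ 1 2 _ (begin
  3                                   ≤⟨ ℕ.*-mono-≤ 3≤∣a∣ (ℕ.*-mono-≤ 1≤M 1≤M) ⟩
  ∣ a ∣ ℕ.* (M ℕ.* M)                 ≡⟨ sym (trans (ℤ.abs-* a (+ M * + M))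
                                                  (cong (∣ a ∣ ℕ.*_) (ℤ.abs-* (+ M) (+ M)))) ⟩
  ∣ A ∣                               ≡⟨ cong ∣_∣ (minus-plus A) ⟩
  ∣ A - + 1 + + 1 ∣                   ≤⟨ ℤ.∣i+j∣≤∣i∣+∣j∣ (A - + 1) (+ 1) ⟩
  ∣ A - + 1 ∣ ℕ.+ 1                   ∎)
  where
  open ℕ.≤-Reasoning
  A : ℤ
  A = a * (+ M * + M)
  minus-plus : ∀ x → x ≡ x - + 1 + + 1
  minus-plus = solve-∀

-- A prime factor q of a·M² − 1, M = B!, does not divide B!, so q > B; and
-- (a·M)² − a = a·(a·M² − 1).
∃large-prime-∣s²-a : ∀ {a} → 3 ℕ.≤ ∣ a ∣ → ∀ B →
                     ∃ λ q → Prime q × B ℕ.< q × ∃ λ s → + q ∣ s * s - a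
∃large-prime-∣s²-a {a} 3≤∣a∣ B with ∃prime∣ (2≤∣a*M²-1∣ a (B !) 3≤∣a∣ (ℕ.1≤n! B))
... | q , q-prime , q∣n = q , q-prime , prime∤n!⇒n< B q-prime q∤M , a * M , q∣s²-a
  where
  M : ℤ
  M = + (B !)
  q∣aM²-1 : + q ∣ a * (M * M) - + 1
  q∣aM²-1 = ∣ᵤ⇒∣ q∣n
  cancel : ∀ x → x - (x - + 1) ≡ + 1
  cancel = solve-∀
  q∤M : ¬ q ℕ.∣ B !
  q∤M q∣M = ¬prime[1] (subst Prime (ℕ.∣1⇒≡1 (∣⇒∣ᵤ q∣1)) q-prime)
    where
    q∣1 : + q ∣ + 1
    q∣1 = subst (+ q ∣_) (cancel (a * (M * M)))
            (∣m∣n⇒∣m-n (∣n⇒∣m*n a {M * M} (∣m⇒∣m*n M (∣ᵤ⇒∣ {+ q} {M} q∣M))) q∣aM²-1)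
  factor : ∀ a M → (a * M) * (a * M) - a ≡ a * (a * (M * M) - + 1)
  factor = solve-∀
  q∣s²-a : + q ∣ (a * M) * (a * M) - a
  q∣s²-a = subst (+ q ∣_) (sym (factor a M)) (∣n⇒∣m*n a q∣aM²-1)

-- The bound B + resultant c makes q odd and prime to the resultant.
exact-at-large-prime : ∀ c B → ∃ λ q → Prime q × B ℕ.< q × ∃ λ x → q ∥ f c x
exact-at-large-prime c B =
  let q , q-prime , B+R<q , s , q∣s²-a = ∃large-prime-∣s²-a {aOf c} (3≤∣aOf∣ c) (B ℕ.+ R)
      R<q = ℕ.≤-<-trans (ℕ.m≤n+m R B) B+R<q
  in  q , q-prime , ℕ.≤-<-trans (ℕ.m≤m+n B R) B+R<q ,
      exact-from-root c q-prime (q≢2 R<q) (q∤R R<q) {s} q∣s²-a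
  where
  R : ℕ
  R = resultant c
  q≢2 : ∀ {q} → R ℕ.< q → q ≢ 2
  q≢2 R<2 refl = ℕ.<⇒≱ (Splitting.1<resultant (splitting c)) (ℕ.≤-pred R<2)
  q∤R : ∀ {q} → R ℕ.< q → ¬ + q ∣ + R
  q∤R R<q q∣R = ℕ.>⇒∤ {{R≢0}} R<q (∣⇒∣ᵤ q∣R)
    where R≢0 = ℕ.>-nonZero (ℕ.<-trans (s≤s z≤n) (Splitting.1<resultant (splitting c)))

∣∣≤sum : ∀ ds → All (λ d → ∣ d ∣ ℕ.≤ sum (List.map ∣_∣ ds)) ds
∣∣≤sum []       = []
∣∣≤sum (d ∷ ds) =
  ℕ.m≤m+n ∣ d ∣ _ ∷ All.map (λ ∣e∣≤Σ → ℕ.≤-trans ∣e∣≤Σ (ℕ.m≤n+m _ ∣ d ∣)) (∣∣≤sum ds)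

∣∣<∧nonsquare⇒∤ : ∀ {q d} → ∣ d ∣ ℕ.< q → ¬ IsSquare d → ¬ + q ∣ d
∣∣<∧nonsquare⇒∤ {q} {d} ∣d∣<q d-nonsquare q∣d = ℕ.>⇒∤ {{∣d∣≢0}} ∣d∣<q (∣⇒∣ᵤ q∣d)
  where
  ∣d∣≢0 : ℕ.NonZero ∣ d ∣
  ∣d∣≢0 = ℕ.≢-nonZero (λ ∣d∣≡0 → d-nonsquare (+ 0 , ℤ.∣i∣≡0⇒i≡0 ∣d∣≡0))

theorem2p12 : (c : Case) (p : ℕ) → Prime p → ¬ (p ≡ 2) → IsSquareMod (aOf c) p →
    (ds : List ℤ) →
    ∃ λ u → ¬ IsSquare (f c u) × Ramifies p (f c u) ×
      All (λ d → ¬ IsSquare d → ¬ SameField d (f c u)) ds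
theorem2p12 c p p-prime p≢2 a-square ds =
  let x , p∥fx = exact-at-prime c p-prime p≢2 a-square
      q , q-prime , B<q , y , q∥fy = exact-at-large-prime c (p ℕ.+ sum (List.map ∣_∣ ds))
      p<q = ℕ.≤-<-trans (ℕ.m≤m+n p _) B<q
      p⊥q = Coprime.sym (prime⇒coprime q-prime {{prime⇒nonZero p-prime}} p<q)
      u , u≡x , u≡y = crt (coprime-² p⊥q) x y
      p∥fu = ∥-resp-≡-mod p∥fx (f-cong-mod c (square-modulus p u≡x))
      q∥fu = ∥-resp-≡-mod q∥fy (f-cong-mod c (square-modulus q u≡y))
      Σ<q : ∀ {i} → i ℕ.≤ sum (List.map ∣_∣ ds) → i ℕ.< q
      Σ<q i≤Σ = ℕ.≤-<-trans (ℕ.≤-trans i≤Σ (ℕ.m≤n+m _ p)) B<q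
  in  u , ∥⇒¬IsSquare p-prime p∥fu , ∥⇒Ramifies p-prime p∥fu ,
      All.map (λ {d} ∣d∣≤Σ d-nonsquare →
                 ∥∧∤⇒¬SameField q-prime q∥fu (∣∣<∧nonsquare⇒∤ {q} {d} (Σ<q ∣d∣≤Σ) d-nonsquare))
              (∣∣≤sum ds)
  where
  square-modulus : ∀ m {u x} → u ≡ x [mod + (m ℕ.* m) ] → u ≡ x [mod + m * + m ]
  square-modulus m {u} {x} = subst (λ k → u ≡ x [mod k ]) (ℤ.pos-* m m)
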